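{- Let $d\ge 1$ and $n$ be integers with $(d+1)\mid n$. For every simple, loopless, $n$-vertex, $d$-regular graph $G$, $$ p_4(G) - c_4(G) \geq p_4\!\left(\tfrac{n}{d+1}K_{d+1}\right) - c_4\!\left(\tfrac{n}{d+1}K_{d+1}\right), $$ with equality if and only if $G$ is (isomorphic to) $\tfrac{n}{d+1}K_{d+1}$.
   Context: $p_4(G)$ is the number of (not necessarily induced) paths on four vertices in $G$ (subgraphs isomorphic to $P_4$), and $c_4(G)$ is the number of (not necessarily induced) cycles on four vertices in $G$ (subgraphs isomorphic to $C_4$). $\tfrac{n}{d+1}K_{d+1}$ is the disjoint union of $n/(d+1)$ copies of the complete graph $K_{d+1}$. -}

module Defs where

open import Data.Bool using (Bool; true; false; not; _∧_; if_then_else_)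
open import Data.Nat using (ℕ; zero; suc; _+_; _/_; _≡ᵇ_)
open import Data.Fin using (Fin; toℕ)
open import Data.Fin.Properties using (_≟_)
open import Data.List using (List; map; allFin)
open import Data.Nat.ListAction using (sum)
open import Data.Product using (Σ; _×_)
open import Relation.Nullary.Decidable using (does)
open import Relation.Binary.PropositionalEquality using (_≡_; refl; cong; cong₂) renaming (sym to ≡-sym)
open import Relation.Nullary using (yes; no)
open import Data.Empty using (⊥-elim)
open import Function.Bundles using (_↔_; Inverse)

record Graph (n : ℕ) : Set where
  field
    adj   : Fin n → Fin n → Bool
    sym   : ∀ u v → adj u v ≡ adj v u
    loopless : ∀ v → adj v v ≡ false
open Graph public

Σv : ∀ {n} → (Fin n → ℕ) → ℕ
Σv {n} f = sum (map f (allFin n))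

[_] : Bool → ℕ
[ b ] = if b then 1 else 0

_≠_ : ∀ {n} → Fin n → Fin n → Bool
a ≠ b = not (does (a ≟ b))

degree : ∀ {n} → Graph n → Fin n → ℕ
degree G v = Σv λ u → [ adj G v u ]

Regular : ∀ {n} → ℕ → Graph n → Set
Regular d G = ∀ v → degree G v ≡ d

distinct4 : ∀ {n} → Fin n → Fin n → Fin n → Fin n → Bool
distinct4 a b c d = (a ≠ b) ∧ (a ≠ c) ∧ (a ≠ d) ∧ (b ≠ c) ∧ (b ≠ d) ∧ (c ≠ d)

p4-ordered : ∀ {n} → Graph n → ℕ
p4-ordered G = Σv λ a → Σv λ b → Σv λ c → Σv λ d →
  [ distinct4 a b c d ∧ adj G a b ∧ adj G b c ∧ adj G c d ]

c4-ordered : ∀ {n} → Graph n → ℕ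
c4-ordered G = Σv λ a → Σv λ b → Σv λ c → Σv λ d →
  [ distinct4 a b c d ∧ adj G a b ∧ adj G b c ∧ adj G c d ∧ adj G d a ]

-- number of (not necessarily induced) subgraphs isomorphic to P4 / C4:
-- injective homomorphisms divided by |Aut P4| = 2, |Aut C4| = 8.
p4 : ∀ {n} → Graph n → ℕ
p4 G = p4-ordered G / 2

c4 : ∀ {n} → Graph n → ℕ
c4 G = c4-ordered G / 8

-- (n/(d+1)) K_{d+1} on Fin n: u ~ v iff u ≠ v and they lie in the same
-- block {k(d+1), ..., k(d+1)+d}.
sameBlock : ∀ {n} (d : ℕ) → Fin n → Fin n → Bool
sameBlock d u v = (toℕ u / suc d) ≡ᵇ (toℕ v / suc d)

≡ᵇ-sym : ∀ m k → (m ≡ᵇ k) ≡ (k ≡ᵇ m)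
≡ᵇ-sym zero zero = refl
≡ᵇ-sym zero (suc k) = refl
≡ᵇ-sym (suc m) zero = refl
≡ᵇ-sym (suc m) (suc k) = ≡ᵇ-sym m k

≠-sym : ∀ {n} (a b : Fin n) → (a ≠ b) ≡ (b ≠ a)
≠-sym a b with a ≟ b | b ≟ a
... | yes _ | yes _ = refl
... | no _ | no _ = refl
... | yes p | no q = ⊥-elim (q (≡-sym p))
... | no p | yes q = ⊥-elim (p (≡-sym q))

≠-irrefl : ∀ {n} (a : Fin n) → (a ≠ a) ≡ false
≠-irrefl a with a ≟ a
... | yes _ = refl
... | no p = ⊥-elim (p refl)

cliquesAdj : ∀ {n} (d : ℕ) → Fin n → Fin n → Bool
cliquesAdj d u v = (u ≠ v) ∧ sameBlock d u v

disjointCliques : (n d : ℕ) → Graph n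
disjointCliques n d = record
  { adj = cliquesAdj d
  ; sym = λ u v → cong₂ _∧_ (≠-sym u v) (≡ᵇ-sym (toℕ u / suc d) (toℕ v / suc d))
  ; loopless = λ v → cong (_∧ sameBlock d v v) (≠-irrefl v)
  }

Isomorphic : ∀ {n} → Graph n → Graph n → Set
Isomorphic {n} G H = Σ (Fin n ↔ Fin n) λ σ →
  ∀ u v → adj G u v ≡ adj H (Inverse.to σ u) (Inverse.to σ v)

-- Count ordered copies (injective homomorphisms) of small graphs in a d-regular graph on n vertices:
-- P4 + C3 = n d (d-1)^2, since a path a-b-c-e is an edge bc with a further neighbour at each end, the
-- degenerate choices a = e being exactly the triangles; C4 + P3 = Σ_{u≠w} codeg(u,w)^2; and P3 = n d (d-1).
-- With p4 = P4/2 and c4 = C4/8 this makes 8 (p4 - c4) a constant minus (4 C3 + Σ_{u≠w} codeg(u,w)^2), so the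
-- theorem amounts to the bound 4 C3 + Σ_{u≠w} codeg(u,w)^2 ≤ (d+3) P3. It holds termwise, because the common
-- neighbours of u and w lie in N(u) \ {w}, and it is tight exactly when any two vertices with a common
-- neighbour are adjacent. Such a d-regular graph is a disjoint union of copies of K_{d+1}.

module Submission where

open import Defs renaming (sym to adj-sym)
open import Data.Bool using (Bool; true; false; _∧_)
open import Data.Bool.Properties
  using (∧-zeroʳ; ∧-identityʳ; ∧-comm; ∧-conicalʳ; ∧-idempotentCommutativeMonoid; T-≡; ⇔→≡) renaming (_≟_ to _≟ᵇ_)
open import Data.Empty using (⊥-elim)
open import Data.Fin using (Fin; zero; suc; toℕ; fromℕ<; punchOut)
open import Data.Fin.Properties
  using (_≟_; toℕ<n; toℕ-injective; toℕ-inject; toℕ-fromℕ<; ¬∀⟶∃¬-smallest; any?; punchOut-injective; injective⇒≤)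
open import Data.List using (map; tabulate)
open import Data.Nat using (ℕ; zero; suc; _+_; _*_; _≤_; _<_; _≥_; _<?_; z≤n; s≤s; _/_; _≡ᵇ_)
open import Data.Nat.DivMod using (m*n/n≡m; m/n*n≤m; /-monoˡ-≤; +-distrib-/-∣ˡ; +-distrib-/-∣ʳ; m<n⇒m/n≡0; m<n*o⇒m/o<n; n/n≡1)
open import Data.Nat.Divisibility using (_∣_; divides; ∣m∣n⇒∣m+n; m∣m*n; *-monoʳ-∣; ∣m⇒∣m*n; ∣n⇒∣m*n)
open import Data.Nat.ListAction using () renaming (sum to listSum)
open import Data.Nat.Properties hiding (_≟_)
open import Data.Nat.Tactic.RingSolver using (solve-∀)
open import Data.Product using (Σ; ∃; _×_; _,_; proj₁; proj₂)
open import Data.Sum using (_⊎_; inj₁; inj₂)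
open import Function using (id; _∘_)
open import Function.Bundles using (_⇔_; _↔_; mk⇔; mk↔ₛ′; Equivalence; Injection)
open import Function.Construct.Composition using (_⇔-∘_)
open import Function.Properties.Inverse using (↔⇒↣)
open import Relation.Binary.Definitions using (tri<; tri≈; tri>)
open import Relation.Binary.PropositionalEquality hiding ([_])
open import Relation.Nullary using (¬_; Dec; yes; no)
open import Relation.Nullary.Decidable using (does; dec-true; dec-false; _⊎-dec_; ¬?; decidable-stable)
open import Algebra.Properties.CommutativeSemigroup *-commutativeSemigroup using () renaming (interchange to *-interchange)
open import Algebra.Properties.Semiring.Sum +-*-semiring
  using (sum; sum-syntax; sum-cong-≗; sum-replicate-zero; ∑-distrib-+; ∑-comm; *-distribˡ-sum; *-distribʳ-sum)
open import Algebra.Solver.IdempotentCommutativeMonoid ∧-idempotentCommutativeMonoid using (solve; _⊜_; _⊕_)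

Σv≡∑ : ∀ {n} (f : Fin n → ℕ) → Σv f ≡ ∑[ i < n ] f i
Σv≡∑ {n} f = listSum-tabulate n id
  where
  listSum-tabulate : ∀ k (g : Fin k → Fin n) → listSum (map f (tabulate g)) ≡ ∑[ i < k ] f (g i)
  listSum-tabulate zero    g = refl
  listSum-tabulate (suc k) g = cong (f (g zero) +_) (listSum-tabulate k (λ i → g (suc i)))

∑-const : ∀ n c → ∑[ i < n ] c ≡ n * c
∑-const zero    c = refl
∑-const (suc n) c = cong (c +_) (∑-const n c)

∑-δ : ∀ {n} (i : Fin n) (f : Fin n → ℕ) → ∑[ j < n ] ([ does (i ≟ j) ] * f j) ≡ f i
∑-δ {suc n} zero    f = trans (cong (1 * f zero +_) (sum-replicate-zero n)) (trans (+-identityʳ _) (*-identityˡ _))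
∑-δ {suc n} (suc i) f = ∑-δ i (λ j → f (suc j))

∑-split : ∀ {n} (i : Fin n) (f : Fin n → ℕ) → ∑[ j < n ] f j ≡ f i + ∑[ j < n ] ([ i ≠ j ] * f j)
∑-split {n} i f = begin
  ∑[ j < n ] f j
    ≡⟨ sum-cong-≗ (λ j → sym (δ+≠ j)) ⟩
  ∑[ j < n ] ([ does (i ≟ j) ] * f j + [ i ≠ j ] * f j)
    ≡⟨ ∑-distrib-+ (λ j → [ does (i ≟ j) ] * f j) (λ j → [ i ≠ j ] * f j) ⟩
  ∑[ j < n ] ([ does (i ≟ j) ] * f j) + ∑[ j < n ] ([ i ≠ j ] * f j)
    ≡⟨ cong (_+ ∑[ j < n ] ([ i ≠ j ] * f j)) (∑-δ i f) ⟩
  f i + ∑[ j < n ] ([ i ≠ j ] * f j) ∎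
  where
  open ≡-Reasoning
  δ+≠ : ∀ j → [ does (i ≟ j) ] * f j + [ i ≠ j ] * f j ≡ f j
  δ+≠ j with does (i ≟ j)
  ... | true  = trans (+-identityʳ _) (+-identityʳ _)
  ... | false = +-identityʳ _

≤-∑ : ∀ {n} (f : Fin n → ℕ) (i : Fin n) → f i ≤ ∑[ j < n ] f j
≤-∑ f zero    = m≤m+n _ _
≤-∑ f (suc i) = ≤-trans (≤-∑ (λ j → f (suc j)) i) (m≤n+m _ _)

∑-mono-≤ : ∀ {n} {f g : Fin n → ℕ} → (∀ i → f i ≤ g i) → ∑[ i < n ] f i ≤ ∑[ i < n ] g i
∑-mono-≤ {zero}  f≤g = z≤n
∑-mono-≤ {suc n} f≤g = +-mono-≤ (f≤g zero) (∑-mono-≤ (λ i → f≤g (suc i)))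

∑-mono-< : ∀ {n} {f g : Fin n → ℕ} → (∀ i → f i ≤ g i) → (i : Fin n) → f i < g i →
           ∑[ i < n ] f i < ∑[ i < n ] g i
∑-mono-< f≤g zero    fi<gi = +-mono-<-≤ fi<gi (∑-mono-≤ (λ i → f≤g (suc i)))
∑-mono-< f≤g (suc i) fi<gi = +-mono-≤-< (f≤g zero) (∑-mono-< (λ i → f≤g (suc i)) i fi<gi)

∑-mono-≤-≡⇒≗ : ∀ {n} {f g : Fin n → ℕ} → (∀ i → f i ≤ g i) →
               ∑[ i < n ] f i ≡ ∑[ i < n ] g i → ∀ i → f i ≡ g i
∑-mono-≤-≡⇒≗ {f = f} {g} f≤g ∑f≡∑g i with f i Data.Nat.≟ g i
... | yes fi≡gi = fi≡gi
... | no  fi≢gi = ⊥-elim (<-irrefl ∑f≡∑g (∑-mono-< f≤g i (≤∧≢⇒< (f≤g i) fi≢gi)))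

∑∑-distrib-+ : ∀ {n} (f g : Fin n → Fin n → ℕ) →
               ∑[ i < n ] ∑[ j < n ] (f i j + g i j) ≡ ∑[ i < n ] ∑[ j < n ] f i j + ∑[ i < n ] ∑[ j < n ] g i j
∑∑-distrib-+ {n} f g = trans (sum-cong-≗ λ i → ∑-distrib-+ (f i) (g i))
                             (∑-distrib-+ (λ i → ∑[ j < n ] f i j) (λ i → ∑[ j < n ] g i j))

*-distribˡ-∑∑ : ∀ {n} k (f : Fin n → Fin n → ℕ) → k * ∑[ i < n ] ∑[ j < n ] f i j ≡ ∑[ i < n ] ∑[ j < n ] (k * f i j)
*-distribˡ-∑∑ {n} k f = trans (*-distribˡ-sum k (λ i → ∑[ j < n ] f i j)) (sum-cong-≗ λ i → *-distribˡ-sum k (f i))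

∑∑-symmetric-even : ∀ {n} (g : Fin n → Fin n → ℕ) → (∀ i j → g i j ≡ g j i) → (∀ i → g i i ≡ 0) →
                    ∃ λ k → ∑[ i < n ] ∑[ j < n ] g i j ≡ k + k
∑∑-symmetric-even {zero}  g g-sym g-diag = 0 , refl
∑∑-symmetric-even {suc n} g g-sym g-diag
  with ∑∑-symmetric-even (λ i j → g (suc i) (suc j)) (λ i j → g-sym (suc i) (suc j)) (λ i → g-diag (suc i))
... | k , ∑∑≡k+k = row + k , (begin
  (g zero zero + row) + ∑[ i < n ] (g (suc i) zero + ∑[ j < n ] g (suc i) (suc j))
    ≡⟨ cong₂ _+_ (cong (_+ row) (g-diag zero)) (∑-distrib-+ (λ i → g (suc i) zero) (λ i → ∑[ j < n ] g (suc i) (suc j))) ⟩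
  row + (∑[ i < n ] g (suc i) zero + ∑[ i < n ] ∑[ j < n ] g (suc i) (suc j))
    ≡⟨ cong₂ (λ column rest → row + (column + rest)) (sum-cong-≗ (λ i → g-sym (suc i) zero)) ∑∑≡k+k ⟩
  row + (row + (k + k))
    ≡⟨ interchange row k ⟩
  (row + k) + (row + k) ∎)
  where
  open ≡-Reasoning
  row : ℕ
  row = ∑[ j < n ] g zero (suc j)
  interchange : ∀ a b → a + (a + (b + b)) ≡ (a + b) + (a + b)
  interchange = solve-∀

codegree-term-≤ : ∀ {d} (adjacent distinct : Bool) c → (adjacent ≡ true → distinct ≡ true) →
                  c + [ adjacent ] ≤ d → 4 * ([ adjacent ] * c) + [ distinct ] * (c * c) ≤ (d + 3) * ([ distinct ] * c)
codegree-term-≤     false false c _      _     = z≤n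
codegree-term-≤ {d} false true  c _      c≤d   rewrite *-identityˡ c | *-identityˡ (c * c) =
  *-monoˡ-≤ c (≤-trans c≤d (m≤m+n d 3))
codegree-term-≤     true  false c ⇒dist  _     with () ← ⇒dist refl
codegree-term-≤ {d} true  true  c _      c+1≤d rewrite *-identityˡ c | *-identityˡ (c * c) = begin
  4 * c + c * c  ≡⟨ *-distribʳ-+ c 4 c ⟨
  (4 + c) * c    ≤⟨ *-monoˡ-≤ c (≤-trans (≤-reflexive (trans (+-comm 4 c) (sym (+-assoc c 1 3)))) (+-monoˡ-≤ 3 c+1≤d)) ⟩
  (d + 3) * c    ∎
  where open ≤-Reasoning

codegree-term-tight : ∀ {d} (adjacent distinct : Bool) c → c + [ adjacent ] ≤ d →
                      4 * ([ adjacent ] * c) + [ distinct ] * (c * c) ≡ (d + 3) * ([ distinct ] * c) →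
                      distinct ≡ true → 0 < c → adjacent ≡ true
codegree-term-tight     true  _    _       _   _  _    _ = refl
codegree-term-tight {d} false true (suc c) c≤d eq refl _
  rewrite *-identityˡ (suc c * suc c) | *-identityˡ (suc c) =
  ⊥-elim (m+1+n≰m d (subst (_≤ d) (*-cancelʳ-≡ (suc c) (d + 3) (suc c) eq) c≤d))

codegree-term-exact : ∀ {d} (adjacent distinct : Bool) c → (adjacent ≡ true → distinct ≡ true) →
                      (adjacent ≡ true → c + 1 ≡ d) → (adjacent ≡ false → distinct ≡ true → c ≡ 0) →
                      4 * ([ adjacent ] * c) + [ distinct ] * (c * c) ≡ (d + 3) * ([ distinct ] * c)
codegree-term-exact {d} false false c _ _ _ = sym (*-zeroʳ (d + 3))
codegree-term-exact {d} false true  c _ _ c≡0 rewrite c≡0 refl refl = sym (*-zeroʳ (d + 3))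
codegree-term-exact     true  false c ⇒dist _ _ with () ← ⇒dist refl
codegree-term-exact     true  true  c _ c+1≡d _ rewrite sym (c+1≡d refl) = exact c
  where
  exact : ∀ c → 4 * (1 * c) + 1 * (c * c) ≡ (c + 1 + 3) * (1 * c)
  exact = solve-∀

halve : ∀ m x k → m + (x + x) ≡ k + k → m / 2 + x ≡ k
halve m x k m+2x≡2k with m≤n⇒∃[o]m+o≡n {x} {k} (≮⇒≥ λ k<x → <-irrefl refl
                           (<-≤-trans (+-mono-< k<x k<x) (subst (x + x ≤_) m+2x≡2k (m≤n+m (x + x) m))))
... | j , refl = begin
  m / 2 + x      ≡⟨ cong (λ m → m / 2 + x) m≡j*2 ⟩
  j * 2 / 2 + x  ≡⟨ cong (_+ x) (m*n/n≡m j 2) ⟩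
  j + x          ≡⟨ +-comm j x ⟩
  x + j          ∎
  where
  open ≡-Reasoning
  regroup : ∀ x j → (x + j) + (x + j) ≡ j * 2 + (x + x)
  regroup = solve-∀
  m≡j*2 : m ≡ j * 2
  m≡j*2 = +-cancelʳ-≡ (x + x) m (j * 2) (trans m+2x≡2k (regroup x j))

[a+x*8]/8≡a/8+x : ∀ a x → (a + x * 8) / 8 ≡ a / 8 + x
[a+x*8]/8≡a/8+x a x = trans (+-distrib-/-∣ʳ a (divides x refl)) (cong ((a / 8) +_) (m*n/n≡m x 8))

floor-≤ : ∀ a x y → a + x * 8 ≤ y * 8 → a / 8 + x ≤ y
floor-≤ a x y a+8x≤8y = begin
  a / 8 + x        ≡⟨ [a+x*8]/8≡a/8+x a x ⟨
  (a + x * 8) / 8  ≤⟨ /-monoˡ-≤ 8 a+8x≤8y ⟩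
  y * 8 / 8        ≡⟨ m*n/n≡m y 8 ⟩
  y                ∎
  where open ≤-Reasoning

floor-≡ : ∀ a x y → a + x * 8 ≤ y * 8 → (a / 8 + x ≡ y ⇔ a + x * 8 ≡ y * 8)
floor-≡ a x y a+8x≤8y = mk⇔ to from
  where
  to : a / 8 + x ≡ y → a + x * 8 ≡ y * 8
  to a/8+x≡y = ≤-antisym a+8x≤8y (begin
    y * 8                  ≡⟨ cong (_* 8) a/8+x≡y ⟨
    (a / 8 + x) * 8        ≡⟨ *-distribʳ-+ 8 (a / 8) x ⟩
    a / 8 * 8 + x * 8      ≤⟨ +-monoˡ-≤ (x * 8) (m/n*n≤m a 8) ⟩
    a + x * 8              ∎)
    where open ≤-Reasoning
  from : a + x * 8 ≡ y * 8 → a / 8 + x ≡ y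
  from a+8x≡8y = trans (sym ([a+x*8]/8≡a/8+x a x)) (trans (cong (_/ 8) a+8x≡8y) (m*n/n≡m y 8))

exchange-≤ : ∀ {p x p₀ x₀ c c₀} → p + x ≡ p₀ + x₀ → c + x ≤ c₀ + x₀ → p₀ + c ≤ p + c₀
exchange-≤ {p} {x} {p₀} {x₀} {c} {c₀} p+x≡p₀+x₀ c+x≤c₀+x₀ = +-cancelʳ-≤ x (p₀ + c) (p + c₀) (begin
  p₀ + c + x    ≡⟨ +-assoc p₀ c x ⟩
  p₀ + (c + x)  ≤⟨ +-monoʳ-≤ p₀ c+x≤c₀+x₀ ⟩
  p₀ + (c₀ + x₀) ≡⟨ swap p₀ c₀ x₀ ⟩
  p₀ + x₀ + c₀  ≡⟨ cong (_+ c₀) p+x≡p₀+x₀ ⟨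
  p + x + c₀    ≡⟨ swap′ p x c₀ ⟩
  p + c₀ + x    ∎)
  where
  open ≤-Reasoning
  swap : ∀ a b c → a + (b + c) ≡ a + c + b
  swap = solve-∀
  swap′ : ∀ a b c → a + b + c ≡ a + c + b
  swap′ = solve-∀

exchange-≡ : ∀ {p x p₀ x₀ c c₀} → p + x ≡ p₀ + x₀ → (p₀ + c ≡ p + c₀ ⇔ c + x ≡ c₀ + x₀)
exchange-≡ {p} {x} {p₀} {x₀} {c} {c₀} p+x≡p₀+x₀ = mk⇔
  (λ p₀+c≡p+c₀ → +-cancelˡ-≡ p₀ (c + x) (c₀ + x₀) (begin
    p₀ + (c + x)    ≡⟨ +-assoc p₀ c x ⟨
    p₀ + c + x      ≡⟨ cong (_+ x) p₀+c≡p+c₀ ⟩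
    p + c₀ + x      ≡⟨ swap′ p c₀ x ⟩
    p + x + c₀      ≡⟨ cong (_+ c₀) p+x≡p₀+x₀ ⟩
    p₀ + x₀ + c₀    ≡⟨ swap p₀ c₀ x₀ ⟨
    p₀ + (c₀ + x₀)  ∎))
  (λ c+x≡c₀+x₀ → +-cancelʳ-≡ x (p₀ + c) (p + c₀) (begin
    p₀ + c + x      ≡⟨ +-assoc p₀ c x ⟩
    p₀ + (c + x)    ≡⟨ cong (p₀ +_) c+x≡c₀+x₀ ⟩
    p₀ + (c₀ + x₀)  ≡⟨ swap p₀ c₀ x₀ ⟩
    p₀ + x₀ + c₀    ≡⟨ cong (_+ c₀) p+x≡p₀+x₀ ⟨
    p + x + c₀      ≡⟨ swap′ p x c₀ ⟩
    p + c₀ + x      ∎))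
  where
  open ≡-Reasoning
  swap : ∀ a b c → a + (b + c) ≡ a + c + b
  swap = solve-∀
  swap′ : ∀ a b c → a + b + c ≡ a + c + b
  swap′ = solve-∀

2∣n*[1+n] : ∀ n → 2 ∣ n * suc n
2∣n*[1+n] zero    = divides 0 refl
2∣n*[1+n] (suc n) = subst (2 ∣_) (step n) (∣m∣n⇒∣m+n (2∣n*[1+n] n) (m∣m*n (suc n)))
  where
  step : ∀ n → n * suc n + 2 * suc n ≡ suc n * suc (suc n)
  step = solve-∀

8∣n*[1+n]*[2+n]*[3+n] : ∀ n → 8 ∣ n * suc n * (2 + n) * (3 + n)
8∣n*[1+n]*[2+n]*[3+n] zero    = divides 0 refl
8∣n*[1+n]*[2+n]*[3+n] (suc n) = subst (8 ∣_) (step n)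
  (∣m∣n⇒∣m+n (8∣n*[1+n]*[2+n]*[3+n] n) (∣m⇒∣m*n (3 + n) (*-monoʳ-∣ 4 (2∣n*[1+n] (suc n)))))
  where
  step : ∀ n → n * suc n * (2 + n) * (3 + n) + 4 * (suc n * suc (suc n)) * (3 + n) ≡
               suc n * (2 + n) * (3 + n) * (4 + n)
  step = solve-∀

8∣complete-c4 : ∀ q d′ C → C + q * (2 + d′) * (suc d′ * d′) ≡ q * (2 + d′) * (suc d′ * (d′ * d′)) → 8 ∣ C
8∣complete-c4 q zero    C eq = subst (8 ∣_) (sym (+-cancelʳ-≡ (q * 2 * 0) C 0 eq)) (divides 0 refl)
8∣complete-c4 q (suc m) C eq = subst (8 ∣_) (sym C≡) (∣n⇒∣m*n q (8∣n*[1+n]*[2+n]*[3+n] m))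
  where
  expand : ∀ q m → q * (3 + m) * ((2 + m) * (suc m * suc m)) ≡ q * (m * suc m * (2 + m) * (3 + m)) + q * (3 + m) * ((2 + m) * suc m)
  expand = solve-∀
  C≡ : C ≡ q * (m * suc m * (2 + m) * (3 + m))
  C≡ = +-cancelʳ-≡ (q * (3 + m) * ((2 + m) * suc m)) C _ (trans eq (expand q m))

[∧]≡* : ∀ x y → [ x ∧ y ] ≡ [ x ] * [ y ]
[∧]≡* false y = refl
[∧]≡* true  y = sym (+-identityʳ _)

[]-idem : ∀ x → [ x ] * [ x ] ≡ [ x ]
[]-idem false = refl
[]-idem true  = refl

≢⇒≠ : ∀ {n} {u v : Fin n} → u ≢ v → (u ≠ v) ≡ true
≢⇒≠ {u = u} {v} u≢v with u ≟ v
... | yes u≡v = ⊥-elim (u≢v u≡v)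
... | no  _   = refl

[]*-cong : ∀ x {m k} → (x ≡ true → m ≡ k) → [ x ] * m ≡ [ x ] * k
[]*-cong false _   = refl
[]*-cong true  m≡k = cong (1 *_) (m≡k refl)

LocallyComplete : ∀ {n} → Graph n → Set
LocallyComplete G = ∀ u v w → adj G v u ≡ true → adj G v w ≡ true → u ≢ w → adj G u w ≡ true

≠⇒≢ : ∀ {n} {u v : Fin n} → (u ≠ v) ≡ true → u ≢ v
≠⇒≢ {u = u} u≠u refl with () ← trans (sym u≠u) (≠-irrefl u)

module Counting {n} (G : Graph n) where

  A : Fin n → Fin n → ℕ
  A u v = [ adj G u v ]

  codegree : Fin n → Fin n → ℕ
  codegree v w = ∑[ u < n ] (A v u * A u w)

  adj⇒≢ : ∀ {u v} → adj G u v ≡ true → u ≢ v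
  adj⇒≢ {u} uv refl with () ← trans (sym uv) (loopless G u)

  ≠∧adj : ∀ u v → (u ≠ v) ∧ adj G u v ≡ adj G u v
  ≠∧adj u v with adj G u v in uv
  ... | false = ∧-zeroʳ (u ≠ v)
  ... | true  = trans (∧-identityʳ (u ≠ v)) (≢⇒≠ (adj⇒≢ uv))

  A-sym : ∀ u v → A u v ≡ A v u
  A-sym u v = cong [_] (adj-sym G u v)

  A-diag : ∀ u → A u u ≡ 0
  A-diag u = cong [_] (loopless G u)

  A*≠ : ∀ u v → A u v * [ u ≠ v ] ≡ A u v
  A*≠ u v = trans (sym ([∧]≡* (adj G u v) (u ≠ v))) (cong [_] (trans (∧-comm (adj G u v) (u ≠ v)) (≠∧adj u v)))

  codegree-sym : ∀ v w → codegree v w ≡ codegree w v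
  codegree-sym v w = sum-cong-≗ λ u → trans (*-comm (A v u) _) (cong₂ _*_ (A-sym u w) (A-sym v u))

  Σv⁴≡∑⁴ : (f : Fin n → Fin n → Fin n → Fin n → ℕ) →
           (Σv λ a → Σv λ b → Σv λ c → Σv λ e → f a b c e) ≡ ∑[ a < n ] ∑[ b < n ] ∑[ c < n ] ∑[ e < n ] f a b c e
  Σv⁴≡∑⁴ f = Σv≗∑ λ a → Σv≗∑ λ b → Σv≗∑ λ c → Σv≡∑ (f a b c)
    where
    Σv≗∑ : {g h : Fin n → ℕ} → (∀ i → g i ≡ h i) → Σv g ≡ ∑[ i < n ] h i
    Σv≗∑ {g} g≗h = trans (Σv≡∑ g) (sum-cong-≗ g≗h)

  ends : Fin n → Fin n → Fin n → Fin n → ℕ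
  ends b c a e = (A a b * [ a ≠ c ]) * (A c e * [ b ≠ e ])

  p4-with-middle : Fin n → Fin n → ℕ
  p4-with-middle b c = ∑[ a < n ] ∑[ e < n ] ([ a ≠ e ] * ends b c a e)

  p4-indicator : ∀ a b c e → [ distinct4 a b c e ∧ adj G a b ∧ adj G b c ∧ adj G c e ] ≡
                             A b c * ([ a ≠ e ] * ends b c a e)
  p4-indicator a b c e = begin
    [ distinct4 a b c e ∧ adj G a b ∧ adj G b c ∧ adj G c e ]
      ≡⟨ cong [_] (cong₂ (λ x y → distinct4 a b c e ∧ x ∧ y)
           (sym (≠∧adj a b)) (cong₂ _∧_ (sym (≠∧adj b c)) (sym (≠∧adj c e)))) ⟩
    [ distinct4 a b c e ∧ ((a ≠ b) ∧ adj G a b) ∧ ((b ≠ c) ∧ adj G b c) ∧ ((c ≠ e) ∧ adj G c e) ]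
      ≡⟨ cong [_] (regroup (a ≠ b) (a ≠ c) (a ≠ e) (b ≠ c) (b ≠ e) (c ≠ e) (adj G a b) (adj G b c) (adj G c e)) ⟩
    [ ((b ≠ c) ∧ adj G b c) ∧ (a ≠ e) ∧ ((((a ≠ b) ∧ adj G a b) ∧ (a ≠ c)) ∧ (((c ≠ e) ∧ adj G c e) ∧ (b ≠ e))) ]
      ≡⟨ cong [_] (cong₂ (λ x y → x ∧ (a ≠ e) ∧ y) (≠∧adj b c)
           (cong₂ (λ x y → (x ∧ (a ≠ c)) ∧ (y ∧ (b ≠ e))) (≠∧adj a b) (≠∧adj c e))) ⟩
    [ adj G b c ∧ (a ≠ e) ∧ ((adj G a b ∧ (a ≠ c)) ∧ (adj G c e ∧ (b ≠ e))) ]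
      ≡⟨ trans ([∧]≡* (adj G b c) _) (cong (A b c *_) (trans ([∧]≡* (a ≠ e) _) (cong ([ a ≠ e ] *_)
           (trans ([∧]≡* (adj G a b ∧ (a ≠ c)) _) (cong₂ _*_ ([∧]≡* (adj G a b) (a ≠ c)) ([∧]≡* (adj G c e) (b ≠ e))))))) ⟩
    A b c * ([ a ≠ e ] * ends b c a e) ∎
    where
    open ≡-Reasoning
    regroup : ∀ ab ac ae bc be ce a~b b~c c~e →
              (ab ∧ ac ∧ ae ∧ bc ∧ be ∧ ce) ∧ (ab ∧ a~b) ∧ (bc ∧ b~c) ∧ (ce ∧ c~e) ≡
              (bc ∧ b~c) ∧ ae ∧ (((ab ∧ a~b) ∧ ac) ∧ ((ce ∧ c~e) ∧ be))
    regroup = solve 9 (λ ab ac ae bc be ce a~b b~c c~e →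
      (ab ⊕ ac ⊕ ae ⊕ bc ⊕ be ⊕ ce) ⊕ (ab ⊕ a~b) ⊕ (bc ⊕ b~c) ⊕ (ce ⊕ c~e) ⊜
      (bc ⊕ b~c) ⊕ ae ⊕ (((ab ⊕ a~b) ⊕ ac) ⊕ ((ce ⊕ c~e) ⊕ be))) refl

  c4-indicator : ∀ a b c e → [ distinct4 a b c e ∧ adj G a b ∧ adj G b c ∧ adj G c e ∧ adj G e a ] ≡
                             [ a ≠ c ] * ((A a b * A b c) * ([ b ≠ e ] * (A c e * A e a)))
  c4-indicator a b c e = begin
    [ distinct4 a b c e ∧ adj G a b ∧ adj G b c ∧ adj G c e ∧ adj G e a ]
      ≡⟨ cong [_] (cong₂ (λ x y → distinct4 a b c e ∧ x ∧ y) (sym (≠∧adj a b))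
           (cong₂ _∧_ (sym (≠∧adj b c)) (cong₂ _∧_ (sym (≠∧adj c e)) (sym e~a-absorbs)))) ⟩
    [ distinct4 a b c e ∧ ((a ≠ b) ∧ adj G a b) ∧ ((b ≠ c) ∧ adj G b c) ∧ ((c ≠ e) ∧ adj G c e) ∧ ((a ≠ e) ∧ adj G e a) ]
      ≡⟨ cong [_] (regroup (a ≠ b) (a ≠ c) (a ≠ e) (b ≠ c) (b ≠ e) (c ≠ e) (adj G a b) (adj G b c) (adj G c e) (adj G e a)) ⟩
    [ (a ≠ c) ∧ ((((a ≠ b) ∧ adj G a b) ∧ ((b ≠ c) ∧ adj G b c)) ∧ ((b ≠ e) ∧ (((c ≠ e) ∧ adj G c e) ∧ ((a ≠ e) ∧ adj G e a)))) ]
      ≡⟨ cong [_] (cong₂ (λ x y → (a ≠ c) ∧ (x ∧ ((b ≠ e) ∧ y)))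
           (cong₂ _∧_ (≠∧adj a b) (≠∧adj b c)) (cong₂ _∧_ (≠∧adj c e) e~a-absorbs)) ⟩
    [ (a ≠ c) ∧ ((adj G a b ∧ adj G b c) ∧ ((b ≠ e) ∧ (adj G c e ∧ adj G e a))) ]
      ≡⟨ trans ([∧]≡* (a ≠ c) _) (cong ([ a ≠ c ] *_) (trans ([∧]≡* (adj G a b ∧ adj G b c) _)
           (cong₂ _*_ ([∧]≡* (adj G a b) (adj G b c))
             (trans ([∧]≡* (b ≠ e) _) (cong ([ b ≠ e ] *_) ([∧]≡* (adj G c e) (adj G e a))))))) ⟩
    [ a ≠ c ] * ((A a b * A b c) * ([ b ≠ e ] * (A c e * A e a))) ∎
    where
    open ≡-Reasoning
    e~a-absorbs : (a ≠ e) ∧ adj G e a ≡ adj G e a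
    e~a-absorbs = trans (cong (_∧ adj G e a) (≠-sym a e)) (≠∧adj e a)
    regroup : ∀ ab ac ae bc be ce a~b b~c c~e e~a →
              (ab ∧ ac ∧ ae ∧ bc ∧ be ∧ ce) ∧ (ab ∧ a~b) ∧ (bc ∧ b~c) ∧ (ce ∧ c~e) ∧ (ae ∧ e~a) ≡
              ac ∧ (((ab ∧ a~b) ∧ (bc ∧ b~c)) ∧ (be ∧ ((ce ∧ c~e) ∧ (ae ∧ e~a))))
    regroup = solve 10 (λ ab ac ae bc be ce a~b b~c c~e e~a →
      (ab ⊕ ac ⊕ ae ⊕ bc ⊕ be ⊕ ce) ⊕ (ab ⊕ a~b) ⊕ (bc ⊕ b~c) ⊕ (ce ⊕ c~e) ⊕ (ae ⊕ e~a) ⊜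
      ac ⊕ (((ab ⊕ a~b) ⊕ (bc ⊕ b~c)) ⊕ (be ⊕ ((ce ⊕ c~e) ⊕ (ae ⊕ e~a))))) refl

  p4-ordered≡ : p4-ordered G ≡ ∑[ b < n ] ∑[ c < n ] (A b c * p4-with-middle b c)
  p4-ordered≡ = begin
    p4-ordered G
      ≡⟨ Σv⁴≡∑⁴ (λ a b c e → [ distinct4 a b c e ∧ adj G a b ∧ adj G b c ∧ adj G c e ]) ⟩
    ∑[ a < n ] ∑[ b < n ] ∑[ c < n ] ∑[ e < n ] [ distinct4 a b c e ∧ adj G a b ∧ adj G b c ∧ adj G c e ]
      ≡⟨ (sum-cong-≗ λ a → sum-cong-≗ λ b → sum-cong-≗ λ c → sum-cong-≗ λ e → p4-indicator a b c e) ⟩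
    ∑[ a < n ] ∑[ b < n ] ∑[ c < n ] ∑[ e < n ] (A b c * ([ a ≠ e ] * ends b c a e))
      ≡⟨ trans (∑-comm (λ a b → ∑[ c < n ] ∑[ e < n ] path a b c e))
               (sum-cong-≗ λ b → ∑-comm (λ a c → ∑[ e < n ] path a b c e)) ⟩
    ∑[ b < n ] ∑[ c < n ] ∑[ a < n ] ∑[ e < n ] (A b c * ([ a ≠ e ] * ends b c a e))
      ≡⟨ (sum-cong-≗ λ b → sum-cong-≗ λ c → sym (trans (*-distribˡ-sum (A b c) (λ a → ∑[ e < n ] ([ a ≠ e ] * ends b c a e)))
           (sum-cong-≗ λ a → *-distribˡ-sum (A b c) (λ e → [ a ≠ e ] * ends b c a e)))) ⟩
    ∑[ b < n ] ∑[ c < n ] (A b c * p4-with-middle b c) ∎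
    where
    open ≡-Reasoning
    path : Fin n → Fin n → Fin n → Fin n → ℕ
    path a b c e = A b c * ([ a ≠ e ] * ends b c a e)

  ends-diagonal : ∀ b c a → ends b c a a ≡ A b a * A a c
  ends-diagonal b c a = begin
    (A a b * [ a ≠ c ]) * (A c a * [ b ≠ a ])  ≡⟨ cong₂ (λ x y → (x * y) * (A c a * [ b ≠ a ])) (A-sym a b) (cong [_] (≠-sym a c)) ⟩
    (A b a * [ c ≠ a ]) * (A c a * [ b ≠ a ])  ≡⟨ swap-middle (A b a) [ c ≠ a ] (A c a) [ b ≠ a ] ⟩
    (A b a * [ b ≠ a ]) * (A c a * [ c ≠ a ])  ≡⟨ cong₂ _*_ (A*≠ b a) (trans (A*≠ c a) (A-sym c a)) ⟩
    A b a * A a c                              ∎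
    where
    open ≡-Reasoning
    swap-middle : ∀ w x y z → (w * x) * (y * z) ≡ (w * z) * (y * x)
    swap-middle = solve-∀

  codegree+p4-with-middle : ∀ b c → codegree b c + p4-with-middle b c ≡
                           (∑[ a < n ] (A a b * [ a ≠ c ])) * (∑[ e < n ] (A c e * [ b ≠ e ]))
  codegree+p4-with-middle b c = sym (begin
    (∑[ a < n ] (A a b * [ a ≠ c ])) * (∑[ e < n ] (A c e * [ b ≠ e ]))
      ≡⟨ trans (*-distribʳ-sum (∑[ e < n ] (A c e * [ b ≠ e ])) (λ a → A a b * [ a ≠ c ]))
               (sum-cong-≗ λ a → *-distribˡ-sum (A a b * [ a ≠ c ]) (λ e → A c e * [ b ≠ e ])) ⟩
    ∑[ a < n ] ∑[ e < n ] ends b c a e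
      ≡⟨ sum-cong-≗ (λ a → ∑-split a (ends b c a)) ⟩
    ∑[ a < n ] (ends b c a a + ∑[ e < n ] ([ a ≠ e ] * ends b c a e))
      ≡⟨ ∑-distrib-+ (λ a → ends b c a a) (λ a → ∑[ e < n ] ([ a ≠ e ] * ends b c a e)) ⟩
    ∑[ a < n ] ends b c a a + p4-with-middle b c
      ≡⟨ cong (_+ p4-with-middle b c) (sum-cong-≗ (ends-diagonal b c)) ⟩
    codegree b c + p4-with-middle b c ∎)
    where open ≡-Reasoning

  codegree-except : Fin n → Fin n → Fin n → ℕ
  codegree-except a c b = ∑[ e < n ] ([ b ≠ e ] * (A a e * A e c))

  c4-with-diagonal : Fin n → Fin n → ℕ
  c4-with-diagonal a c = ∑[ b < n ] ((A a b * A b c) * codegree-except a c b)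

  c4-ordered≡ : c4-ordered G ≡
    ∑[ a < n ] ∑[ c < n ] ([ a ≠ c ] * c4-with-diagonal a c)
  c4-ordered≡ = begin
    c4-ordered G
      ≡⟨ Σv⁴≡∑⁴ (λ a b c e → [ distinct4 a b c e ∧ adj G a b ∧ adj G b c ∧ adj G c e ∧ adj G e a ]) ⟩
    ∑[ a < n ] ∑[ b < n ] ∑[ c < n ] ∑[ e < n ] [ distinct4 a b c e ∧ adj G a b ∧ adj G b c ∧ adj G c e ∧ adj G e a ]
      ≡⟨ (sum-cong-≗ λ a → sum-cong-≗ λ b → sum-cong-≗ λ c → sum-cong-≗ λ e → trans (c4-indicator a b c e)
           (cong (λ x → [ a ≠ c ] * ((A a b * A b c) * ([ b ≠ e ] * x)))
                 (trans (*-comm (A c e) (A e a)) (cong₂ _*_ (A-sym e a) (A-sym c e))))) ⟩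
    ∑[ a < n ] ∑[ b < n ] ∑[ c < n ] ∑[ e < n ] cycle a b c e
      ≡⟨ (sum-cong-≗ λ a → ∑-comm (λ b c → ∑[ e < n ] cycle a b c e)) ⟩
    ∑[ a < n ] ∑[ c < n ] ∑[ b < n ] ∑[ e < n ] cycle a b c e
      ≡⟨ (sum-cong-≗ λ a → sum-cong-≗ λ c → sym (trans (*-distribˡ-sum [ a ≠ c ] (λ b → (A a b * A b c) * codegree-except a c b))
           (sum-cong-≗ λ b → trans (cong ([ a ≠ c ] *_) (*-distribˡ-sum (A a b * A b c) (λ e → [ b ≠ e ] * (A a e * A e c))))
             (*-distribˡ-sum [ a ≠ c ] (λ e → (A a b * A b c) * ([ b ≠ e ] * (A a e * A e c))))))) ⟩
    ∑[ a < n ] ∑[ c < n ] ([ a ≠ c ] * c4-with-diagonal a c) ∎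
    where
    open ≡-Reasoning
    cycle : Fin n → Fin n → Fin n → Fin n → ℕ
    cycle a b c e = [ a ≠ c ] * ((A a b * A b c) * ([ b ≠ e ] * (A a e * A e c)))

  c4-with-diagonal+codegree : ∀ a c →
    c4-with-diagonal a c + codegree a c ≡ codegree a c * codegree a c
  c4-with-diagonal+codegree a c = sym (begin
    codegree a c * codegree a c
      ≡⟨ *-distribʳ-sum (codegree a c) (λ b → A a b * A b c) ⟩
    ∑[ b < n ] ((A a b * A b c) * codegree a c)
      ≡⟨ sum-cong-≗ (λ b → cong ((A a b * A b c) *_) (∑-split b (λ e → A a e * A e c))) ⟩
    ∑[ b < n ] ((A a b * A b c) * (A a b * A b c + codegree-except a c b))
      ≡⟨ sum-cong-≗ (λ b → trans (*-distribˡ-+ (A a b * A b c) (A a b * A b c) (codegree-except a c b))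
           (cong (_+ (A a b * A b c) * codegree-except a c b) (idem (adj G a b) (adj G b c)))) ⟩
    ∑[ b < n ] (A a b * A b c + (A a b * A b c) * codegree-except a c b)
      ≡⟨ ∑-distrib-+ (λ b → A a b * A b c) (λ b → (A a b * A b c) * codegree-except a c b) ⟩
    codegree a c + c4-with-diagonal a c
      ≡⟨ +-comm (codegree a c) _ ⟩
    c4-with-diagonal a c + codegree a c ∎)
    where
    open ≡-Reasoning
    idem : ∀ x y → ([ x ] * [ y ]) * ([ x ] * [ y ]) ≡ [ x ] * [ y ]
    idem x y = trans (*-interchange [ x ] [ y ] [ x ] [ y ]) (cong₂ _*_ ([]-idem x) ([]-idem y))

  p3-ordered : ℕ
  p3-ordered = ∑[ a < n ] ∑[ c < n ] ([ a ≠ c ] * codegree a c)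

  codegree²-sum : ℕ
  codegree²-sum = ∑[ a < n ] ∑[ c < n ] ([ a ≠ c ] * (codegree a c * codegree a c))

  c4-ordered+p3-ordered : c4-ordered G + p3-ordered ≡ codegree²-sum
  c4-ordered+p3-ordered = begin
    c4-ordered G + p3-ordered
      ≡⟨ cong (_+ p3-ordered) c4-ordered≡ ⟩
    ∑[ a < n ] ∑[ c < n ] ([ a ≠ c ] * c4-with-diagonal a c) + p3-ordered
      ≡⟨ ∑∑-distrib-+ (λ a c → [ a ≠ c ] * c4-with-diagonal a c) (λ a c → [ a ≠ c ] * codegree a c) ⟨
    ∑[ a < n ] ∑[ c < n ] ([ a ≠ c ] * c4-with-diagonal a c + [ a ≠ c ] * codegree a c)
      ≡⟨ (sum-cong-≗ λ a → sum-cong-≗ λ c → trans (sym (*-distribˡ-+ [ a ≠ c ] _ _))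
           (cong ([ a ≠ c ] *_) (c4-with-diagonal+codegree a c))) ⟩
    codegree²-sum ∎
    where open ≡-Reasoning

  c3-ordered : ℕ
  c3-ordered = ∑[ b < n ] ∑[ c < n ] (A b c * codegree b c)

  c3-ordered-even : ∃ λ x → c3-ordered ≡ x + x
  c3-ordered-even = ∑∑-symmetric-even (λ b c → A b c * codegree b c)
    (λ b c → cong₂ _*_ (A-sym b c) (codegree-sym b c)) (λ b → cong (_* codegree b b) (A-diag b))

  A≤≠ : ∀ u v → A u v ≤ [ u ≠ v ]
  A≤≠ u v with adj G u v in u~v
  ... | false = z≤n
  ... | true  = ≤-reflexive (cong [_] (sym (≢⇒≠ (adj⇒≢ u~v))))

  degree≡ : ∀ {d} → Regular d G → ∀ v → ∑[ u < n ] A v u ≡ d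
  degree≡ regular v = trans (sym (Σv≡∑ (A v))) (regular v)

  module _ {d′} (regular : Regular (suc d′) G) where
    private
      d : ℕ
      d = suc d′

    degree-split : ∀ v w → A v w + ∑[ u < n ] ([ w ≠ u ] * A v u) ≡ d
    degree-split v w = trans (sym (∑-split w (A v))) (degree≡ regular v)

    neighbours-except : ∀ v w → adj G v w ≡ true → ∑[ u < n ] ([ w ≠ u ] * A v u) ≡ d′
    neighbours-except v w v~w =
      suc-injective (trans (cong (λ x → [ x ] + ∑[ u < n ] ([ w ≠ u ] * A v u)) (sym v~w)) (degree-split v w))

    handshake : ∀ k → ∑[ b < n ] ∑[ c < n ] (A b c * k) ≡ n * (d * k)
    handshake k = trans (sum-cong-≗ λ b → trans (sym (*-distribʳ-sum k (A b))) (cong (_* k) (degree≡ regular b))) (∑-const n (d * k))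

    p4-with-middle-on-edge : ∀ b c → adj G b c ≡ true → codegree b c + p4-with-middle b c ≡ d′ * d′
    p4-with-middle-on-edge b c b~c = trans (codegree+p4-with-middle b c) (cong₂ _*_
      (trans (sum-cong-≗ λ a → trans (*-comm (A a b) _) (cong₂ _*_ (cong [_] (≠-sym a c)) (A-sym a b))) (neighbours-except b c b~c))
      (trans (sum-cong-≗ λ e → *-comm (A c e) _) (neighbours-except c b (trans (adj-sym G c b) b~c))))

    p4-ordered+c3-ordered : p4-ordered G + c3-ordered ≡ n * (d * (d′ * d′))
    p4-ordered+c3-ordered = begin
      p4-ordered G + c3-ordered
        ≡⟨ cong (_+ c3-ordered) p4-ordered≡ ⟩
      ∑[ b < n ] ∑[ c < n ] (A b c * p4-with-middle b c) + c3-ordered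
        ≡⟨ ∑∑-distrib-+ (λ b c → A b c * p4-with-middle b c) (λ b c → A b c * codegree b c) ⟨
      ∑[ b < n ] ∑[ c < n ] (A b c * p4-with-middle b c + A b c * codegree b c)
        ≡⟨ (sum-cong-≗ λ b → sum-cong-≗ λ c → trans (sym (*-distribˡ-+ (A b c) (p4-with-middle b c) (codegree b c)))
             ([]*-cong (adj G b c) λ b~c → trans (+-comm (p4-with-middle b c) (codegree b c)) (p4-with-middle-on-edge b c b~c))) ⟩
      ∑[ b < n ] ∑[ c < n ] (A b c * (d′ * d′))
        ≡⟨ handshake (d′ * d′) ⟩
      n * (d * (d′ * d′)) ∎
      where open ≡-Reasoning

    codegree-diagonal : ∀ v → codegree v v ≡ d
    codegree-diagonal v = trans (sum-cong-≗ λ u → trans (cong (A v u *_) (A-sym u v)) ([]-idem (adj G v u))) (degree≡ regular v)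

    ∑codegree : ∀ v → ∑[ w < n ] codegree v w ≡ d * d
    ∑codegree v = begin
      ∑[ w < n ] ∑[ u < n ] (A v u * A u w)  ≡⟨ ∑-comm (λ w u → A v u * A u w) ⟩
      ∑[ u < n ] ∑[ w < n ] (A v u * A u w)  ≡⟨ sum-cong-≗ (λ u → trans (sym (*-distribˡ-sum (A v u) (A u)))
                                                                       (cong (A v u *_) (degree≡ regular u))) ⟩
      ∑[ u < n ] (A v u * d)                 ≡⟨ trans (sym (*-distribʳ-sum d (A v))) (cong (_* d) (degree≡ regular v)) ⟩
      d * d                                  ∎
      where open ≡-Reasoning

    p3-ordered≡ : p3-ordered ≡ n * (d * d′)
    p3-ordered≡ = trans (sum-cong-≗ row) (∑-const n (d * d′))
      where
      row : ∀ a → ∑[ c < n ] ([ a ≠ c ] * codegree a c) ≡ d * d′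
      row a = +-cancelˡ-≡ d _ _ (begin
        d + ∑[ c < n ] ([ a ≠ c ] * codegree a c)              ≡⟨ cong (_+ ∑[ c < n ] ([ a ≠ c ] * codegree a c)) (codegree-diagonal a) ⟨
        codegree a a + ∑[ c < n ] ([ a ≠ c ] * codegree a c)   ≡⟨ ∑-split a (codegree a) ⟨
        ∑[ c < n ] codegree a c                                ≡⟨ ∑codegree a ⟩
        d * d                                                  ≡⟨ *-suc d d′ ⟩
        d + d * d′                                             ∎)
        where open ≡-Reasoning

    codegree+A≤d : ∀ v w → codegree v w + A v w ≤ d
    codegree+A≤d v w = begin
      codegree v w + A v w                          ≤⟨ +-monoˡ-≤ (A v w) (∑-mono-≤ λ u → A*A≤≠*A u) ⟩
      ∑[ u < n ] ([ w ≠ u ] * A v u) + A v w        ≡⟨ +-comm _ (A v w) ⟩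
      A v w + ∑[ u < n ] ([ w ≠ u ] * A v u)        ≡⟨ degree-split v w ⟩
      d                                             ∎
      where
      open ≤-Reasoning
      A*A≤≠*A : ∀ u → A v u * A u w ≤ [ w ≠ u ] * A v u
      A*A≤≠*A u = ≤-trans (*-monoʳ-≤ (A v u) (≤-trans (A≤≠ u w) (≤-reflexive (cong [_] (≠-sym u w))))) (≤-reflexive (*-comm (A v u) _))

    codegree-term : Fin n → Fin n → ℕ
    codegree-term v w = 4 * (A v w * codegree v w) + [ v ≠ w ] * (codegree v w * codegree v w)

    codegree-term≤ : ∀ v w → codegree-term v w ≤ (d + 3) * ([ v ≠ w ] * codegree v w)
    codegree-term≤ v w = codegree-term-≤ (adj G v w) (v ≠ w) (codegree v w) (λ v~w → ≢⇒≠ (adj⇒≢ v~w)) (codegree+A≤d v w)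

    ∑∑codegree-term : ∑[ v < n ] ∑[ w < n ] codegree-term v w ≡ 4 * c3-ordered + codegree²-sum
    ∑∑codegree-term = trans
      (∑∑-distrib-+ (λ v w → 4 * (A v w * codegree v w)) (λ v w → [ v ≠ w ] * (codegree v w * codegree v w)))
      (cong (_+ codegree²-sum) (sym (*-distribˡ-∑∑ 4 (λ v w → A v w * codegree v w))))

    ∑∑codegree-bound : ∑[ v < n ] ∑[ w < n ] ((d + 3) * ([ v ≠ w ] * codegree v w)) ≡ (d + 3) * p3-ordered
    ∑∑codegree-bound = sym (*-distribˡ-∑∑ (d + 3) (λ v w → [ v ≠ w ] * codegree v w))

    triangle-bound : 4 * c3-ordered + codegree²-sum ≤ (d + 3) * p3-ordered
    triangle-bound = begin
      4 * c3-ordered + codegree²-sum                                   ≡⟨ ∑∑codegree-term ⟨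
      ∑[ v < n ] ∑[ w < n ] codegree-term v w                          ≤⟨ ∑-mono-≤ (λ v → ∑-mono-≤ (codegree-term≤ v)) ⟩
      ∑[ v < n ] ∑[ w < n ] ((d + 3) * ([ v ≠ w ] * codegree v w))     ≡⟨ ∑∑codegree-bound ⟩
      (d + 3) * p3-ordered                                             ∎
      where open ≤-Reasoning

    triangle-bound-tight⇒complete : 4 * c3-ordered + codegree²-sum ≡ (d + 3) * p3-ordered → LocallyComplete G
    triangle-bound-tight⇒complete tight u v w v~u v~w u≢w =
      codegree-term-tight (adj G u w) (u ≠ w) (codegree u w) (codegree+A≤d u w) (term≡bound u w) (≢⇒≠ u≢w) 0<codegree
      where
      term≡bound : ∀ u w → codegree-term u w ≡ (d + 3) * ([ u ≠ w ] * codegree u w)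
      term≡bound u = ∑-mono-≤-≡⇒≗ (codegree-term≤ u)
        (∑-mono-≤-≡⇒≗ (λ u → ∑-mono-≤ (codegree-term≤ u)) (trans ∑∑codegree-term (trans tight (sym ∑∑codegree-bound))) u)
      0<codegree : 0 < codegree u w
      0<codegree = ≤-trans (≤-reflexive (cong₂ (λ x y → [ x ] * [ y ]) (sym (trans (adj-sym G u v) v~u)) (sym v~w)))
                           (≤-∑ (λ x → A u x * A x w) v)

    module _ (complete : LocallyComplete G) where

      codegree-on-edge : ∀ {v w} → adj G v w ≡ true → codegree v w + 1 ≡ d
      codegree-on-edge {v} {w} v~w = trans (+-comm _ 1) (cong suc (trans (sum-cong-≗ common) (neighbours-except v w v~w)))
        where
        common : ∀ u → A v u * A u w ≡ [ w ≠ u ] * A v u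
        common u with adj G v u in v~u | u ≟ w
        ... | false | _        = sym (*-zeroʳ [ w ≠ u ])
        ... | true  | yes refl = trans (+-identityʳ (A u u)) (trans (A-diag u) (cong (λ x → [ x ] * 1) (sym (≠-irrefl u))))
        ... | true  | no  u≢w  = trans (cong (λ x → 1 * [ x ]) (complete u v w v~u v~w u≢w))
                                       (cong (λ x → [ x ] * 1) (sym (≢⇒≠ (u≢w ∘ sym))))

      codegree-off-edge : ∀ {v w} → adj G v w ≡ false → v ≢ w → codegree v w ≡ 0
      codegree-off-edge {v} {w} v≁w v≢w = trans (sum-cong-≗ no-common) (sum-replicate-zero n)
        where
        no-common : ∀ u → A v u * A u w ≡ 0
        no-common u with adj G v u in v~u | adj G u w in u~w
        ... | false | _     = refl
        ... | true  | false = refl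
        ... | true  | true  with () ← trans (sym (complete v u w (trans (adj-sym G u v) v~u) u~w v≢w)) v≁w

      complete⇒triangle-bound-tight : 4 * c3-ordered + codegree²-sum ≡ (d + 3) * p3-ordered
      complete⇒triangle-bound-tight = trans (sym ∑∑codegree-term) (trans (sum-cong-≗ λ v → sum-cong-≗ λ w →
        codegree-term-exact (adj G v w) (v ≠ w) (codegree v w) (λ v~w → ≢⇒≠ (adj⇒≢ v~w)) codegree-on-edge
          (λ v≁w v≠w → codegree-off-edge v≁w (≠⇒≢ v≠w))) ∑∑codegree-bound)

      c4-ordered-complete : c4-ordered G + n * (d * d′) ≡ n * (d * (d′ * d′))
      c4-ordered-complete = begin
        c4-ordered G + n * (d * d′)                         ≡⟨ cong (c4-ordered G +_) p3-ordered≡ ⟨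
        c4-ordered G + p3-ordered                           ≡⟨ c4-ordered+p3-ordered ⟩
        codegree²-sum                                       ≡⟨ (sum-cong-≗ λ v → sum-cong-≗ λ w → squares v w) ⟩
        ∑[ v < n ] ∑[ w < n ] (A v w * (d′ * d′))           ≡⟨ handshake (d′ * d′) ⟩
        n * (d * (d′ * d′))                                 ∎
        where
        open ≡-Reasoning
        squares : ∀ v w → [ v ≠ w ] * (codegree v w * codegree v w) ≡ A v w * (d′ * d′)
        squares v w with adj G v w in v~w
        ... | true  = trans (cong (λ x → [ x ] * (codegree v w * codegree v w)) (≢⇒≠ (adj⇒≢ v~w)))
                            (cong (λ c → 1 * (c * c)) (suc-injective (trans (+-comm 1 _) (codegree-on-edge v~w))))
        ... | false with v ≟ w
        ...   | yes _   = refl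
        ...   | no  v≢w = cong (λ c → 1 * (c * c)) (codegree-off-edge v~w v≢w)

    p3-ordered-split : (d + 3) * p3-ordered ≡ (d + 2) * p3-ordered + p3-ordered
    p3-ordered-split = split d p3-ordered
      where
      split : ∀ d s → (d + 3) * s ≡ (d + 2) * s + s
      split = solve-∀

    triangle-bound-rearranged : ∀ x → c3-ordered ≡ x + x →
                                4 * c3-ordered + codegree²-sum ≡ (c4-ordered G + x * 8) + p3-ordered
    triangle-bound-rearranged x c3≡x+x = begin
      4 * c3-ordered + codegree²-sum                 ≡⟨ cong₂ (λ t s → 4 * t + s) c3≡x+x (sym c4-ordered+p3-ordered) ⟩
      4 * (x + x) + (c4-ordered G + p3-ordered)      ≡⟨ regroup x (c4-ordered G) p3-ordered ⟩
      (c4-ordered G + x * 8) + p3-ordered            ∎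
      where
      open ≡-Reasoning
      regroup : ∀ x c s → 4 * (x + x) + (c + s) ≡ (c + x * 8) + s
      regroup = solve-∀

    c4-ordered-bound : ∀ x → c3-ordered ≡ x + x → c4-ordered G + x * 8 ≤ (d + 2) * p3-ordered
    c4-ordered-bound x c3≡x+x = +-cancelʳ-≤ p3-ordered _ _
      (subst₂ _≤_ (triangle-bound-rearranged x c3≡x+x) p3-ordered-split triangle-bound)

    c4-ordered-bound-tight : ∀ x → c3-ordered ≡ x + x →
                             (c4-ordered G + x * 8 ≡ (d + 2) * p3-ordered ⇔ LocallyComplete G)
    c4-ordered-bound-tight x c3≡x+x = mk⇔
      (λ tight → triangle-bound-tight⇒complete
        (trans (triangle-bound-rearranged x c3≡x+x) (trans (cong (_+ p3-ordered) tight) (sym p3-ordered-split))))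
      (λ complete → +-cancelʳ-≡ p3-ordered _ _
        (trans (sym (triangle-bound-rearranged x c3≡x+x))
          (trans (complete⇒triangle-bound-tight complete) p3-ordered-split)))

    n*d-even : ∃ λ e → n * d ≡ e + e
    n*d-even with ∑∑-symmetric-even A A-sym A-diag
    ... | e , ∑∑A≡e+e = e , trans (sym (trans (sum-cong-≗ λ b → sum-cong-≗ λ c → sym (*-identityʳ (A b c)))
                                               (trans (handshake 1) (cong (n *_) (*-identityʳ d))))) ∑∑A≡e+e

    p4+half-c3 : ∀ e x → n * d ≡ e + e → c3-ordered ≡ x + x → p4 G + x ≡ e * (d′ * d′)
    p4+half-c3 e x n*d≡e+e c3≡x+x = halve (p4-ordered G) x (e * (d′ * d′)) (begin
      p4-ordered G + (x + x)      ≡⟨ cong (p4-ordered G +_) c3≡x+x ⟨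
      p4-ordered G + c3-ordered   ≡⟨ p4-ordered+c3-ordered ⟩
      n * (d * (d′ * d′))         ≡⟨ *-assoc n d (d′ * d′) ⟨
      n * d * (d′ * d′)           ≡⟨ cong (_* (d′ * d′)) n*d≡e+e ⟩
      (e + e) * (d′ * d′)         ≡⟨ *-distribʳ-+ (d′ * d′) e e ⟩
      e * (d′ * d′) + e * (d′ * d′) ∎)
      where open ≡-Reasoning

open Counting

-- The hypothesis 8 ∣ c4-ordered H is only needed because c4 rounds down (c4 = c4-ordered / 8).
complete-minimises-p4-c4 : ∀ {n d′} (G H : Graph n) → Regular (suc d′) G → Regular (suc d′) H →
  LocallyComplete H → 8 ∣ c4-ordered H →
  (p4 H + c4 G ≤ p4 G + c4 H) × (p4 H + c4 G ≡ p4 G + c4 H ⇔ LocallyComplete G)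
complete-minimises-p4-c4 {n} {d′} G H G-regular H-regular H-complete (divides r c4-ordered-H≡r*8)
  with n*d-even G G-regular | c3-ordered-even G | c3-ordered-even H
... | e , n*d≡e+e | x , c3-G≡x+x | x₀ , c3-H≡x₀+x₀ =
  exchange-≤ {c = c4 G} {c₀ = c4 H} p+x≡p₀+x₀ (floor-≤ (c4-ordered G) x (c4 H + x₀) c4-G-bound) ,
  c4-G-bound-tight ⇔-∘ (floor-≡ (c4-ordered G) x (c4 H + x₀) c4-G-bound ⇔-∘ exchange-≡ {c = c4 G} {c₀ = c4 H} p+x≡p₀+x₀)
  where
  open ≡-Reasoning
  p+x≡p₀+x₀ : p4 G + x ≡ p4 H + x₀
  p+x≡p₀+x₀ = trans (p4+half-c3 G G-regular e x n*d≡e+e c3-G≡x+x) (sym (p4+half-c3 H H-regular e x₀ n*d≡e+e c3-H≡x₀+x₀))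
  c4-H≡r : c4 H ≡ r
  c4-H≡r = trans (cong (_/ 8) c4-ordered-H≡r*8) (m*n/n≡m r 8)
  bound≡ : (suc d′ + 2) * p3-ordered G ≡ (c4 H + x₀) * 8
  bound≡ = begin
    (suc d′ + 2) * p3-ordered G         ≡⟨ cong ((suc d′ + 2) *_) (trans (p3-ordered≡ G G-regular) (sym (p3-ordered≡ H H-regular))) ⟩
    (suc d′ + 2) * p3-ordered H         ≡⟨ Equivalence.from (c4-ordered-bound-tight H H-regular x₀ c3-H≡x₀+x₀) H-complete ⟨
    c4-ordered H + x₀ * 8               ≡⟨ cong (_+ x₀ * 8) (trans c4-ordered-H≡r*8 (cong (_* 8) (sym c4-H≡r))) ⟩
    c4 H * 8 + x₀ * 8                   ≡⟨ *-distribʳ-+ 8 (c4 H) x₀ ⟨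
    (c4 H + x₀) * 8                     ∎
  c4-G-bound : c4-ordered G + x * 8 ≤ (c4 H + x₀) * 8
  c4-G-bound = subst (c4-ordered G + x * 8 ≤_) bound≡ (c4-ordered-bound G G-regular x c3-G≡x+x)
  c4-G-bound-tight : c4-ordered G + x * 8 ≡ (c4 H + x₀) * 8 ⇔ LocallyComplete G
  c4-G-bound-tight = subst (λ b → c4-ordered G + x * 8 ≡ b ⇔ LocallyComplete G) bound≡ (c4-ordered-bound-tight G G-regular x c3-G≡x+x)

≡ᵇ⇔≡ : ∀ m k → (m ≡ᵇ k) ≡ true ⇔ m ≡ k
≡ᵇ⇔≡ m k = mk⇔ (λ m≡ᵇk → ≡ᵇ⇒≡ m k (Equivalence.from T-≡ m≡ᵇk)) (λ m≡k → Equivalence.to T-≡ (≡⇒≡ᵇ m k m≡k))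

∑-toℕ-+ : ∀ m k (g : ℕ → ℕ) → ∑[ u < m + k ] g (toℕ u) ≡ ∑[ u < m ] g (toℕ u) + ∑[ u < k ] g (m + toℕ u)
∑-toℕ-+ zero    k g = refl
∑-toℕ-+ (suc m) k g = trans (cong (g 0 +_) (∑-toℕ-+ m k (λ x → g (suc x)))) (sym (+-assoc (g 0) _ _))

∑-blocks : ∀ d q (g : ℕ → ℕ) →
           ∑[ u < suc q * suc d ] g (toℕ u / suc d) ≡ suc d * g 0 + ∑[ u < q * suc d ] g (suc (toℕ u / suc d))
∑-blocks d q g = begin
  ∑[ u < suc d + q * suc d ] g (toℕ u / suc d)
    ≡⟨ ∑-toℕ-+ (suc d) (q * suc d) (λ x → g (x / suc d)) ⟩
  ∑[ u < suc d ] g (toℕ u / suc d) + ∑[ u < q * suc d ] g ((suc d + toℕ u) / suc d)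
    ≡⟨ cong₂ _+_ (sum-cong-≗ {x = λ u → g (toℕ u / suc d)} {y = λ _ → g 0} λ u → cong g (m<n⇒m/n≡0 (toℕ<n u)))
                 (sum-cong-≗ {q * suc d} {λ u → g ((suc d + toℕ u) / suc d)} λ u → cong g (first-block-skipped (toℕ u))) ⟩
  ∑[ u < suc d ] g 0 + ∑[ u < q * suc d ] g (suc (toℕ u / suc d))
    ≡⟨ cong (_+ ∑[ u < q * suc d ] g (suc (toℕ u / suc d))) (∑-const (suc d) (g 0)) ⟩
  suc d * g 0 + ∑[ u < q * suc d ] g (suc (toℕ u / suc d)) ∎
  where
  open ≡-Reasoning
  first-block-skipped : ∀ x → (suc d + x) / suc d ≡ suc (x / suc d)
  first-block-skipped x = trans (+-distrib-/-∣ˡ x (divides 1 (sym (*-identityˡ (suc d))))) (cong (_+ x / suc d) (n/n≡1 (suc d)))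

block-size : ∀ d q k → k < q → ∑[ u < q * suc d ] [ k ≡ᵇ toℕ u / suc d ] ≡ suc d
block-size d (suc q) zero    _         = trans (∑-blocks d q (λ b → [ 0 ≡ᵇ b ]))
  (trans (cong (suc d * 1 +_) (sum-replicate-zero (q * suc d))) (trans (+-identityʳ _) (*-identityʳ (suc d))))
block-size d (suc q) (suc k) (s≤s k<q) = trans (∑-blocks d q (λ b → [ suc k ≡ᵇ b ]))
  (trans (cong (_+ ∑[ u < q * suc d ] [ k ≡ᵇ toℕ u / suc d ]) (*-zeroʳ (suc d))) (block-size d q k k<q))

disjointCliques-regular : ∀ q d → Regular d (disjointCliques (q * suc d) d)
disjointCliques-regular q d v = suc-injective (begin
  suc (Σv λ u → [ (v ≠ u) ∧ sameBlock d v u ])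
    ≡⟨ cong suc (trans (Σv≡∑ (λ u → [ (v ≠ u) ∧ sameBlock d v u ]))
                       (sum-cong-≗ λ u → [∧]≡* (v ≠ u) (sameBlock d v u))) ⟩
  suc (∑[ u < q * suc d ] ([ v ≠ u ] * [ sameBlock d v u ]))
    ≡⟨ cong (λ b → [ b ] + ∑[ u < q * suc d ] ([ v ≠ u ] * [ sameBlock d v u ]))
            (sym (Equivalence.from (≡ᵇ⇔≡ (toℕ v / suc d) (toℕ v / suc d)) refl)) ⟩
  [ sameBlock d v v ] + ∑[ u < q * suc d ] ([ v ≠ u ] * [ sameBlock d v u ])
    ≡⟨ ∑-split v (λ u → [ sameBlock d v u ]) ⟨
  ∑[ u < q * suc d ] [ sameBlock d v u ]
    ≡⟨ block-size d q (toℕ v / suc d) (m<n*o⇒m/o<n (toℕ<n v)) ⟩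
  suc d ∎)
  where open ≡-Reasoning

disjointCliques-complete : ∀ n d → LocallyComplete (disjointCliques n d)
disjointCliques-complete n d u v w v~u v~w u≢w = cong₂ _∧_ (≢⇒≠ u≢w)
  (Equivalence.from (≡ᵇ⇔≡ (toℕ u / suc d) (toℕ w / suc d)) (trans (sym (same-block v u v~u)) (same-block v w v~w)))
  where
  same-block : ∀ x y → cliquesAdj d x y ≡ true → toℕ x / suc d ≡ toℕ y / suc d
  same-block x y x~y = Equivalence.to (≡ᵇ⇔≡ (toℕ x / suc d) (toℕ y / suc d)) (∧-conicalʳ (x ≠ y) (sameBlock d x y) x~y)

8∣disjointCliques-c4 : ∀ q d′ → 8 ∣ c4-ordered (disjointCliques (q * (2 + d′)) (suc d′))
8∣disjointCliques-c4 q d′ = 8∣complete-c4 q d′ _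
  (c4-ordered-complete (disjointCliques n (suc d′)) (disjointCliques-regular q (suc d′)) (disjointCliques-complete n (suc d′)))
  where
  n : ℕ
  n = q * (2 + d′)

below : ℕ → ℕ → ℕ
below i j = [ does (i <? j) ]

below-true : ∀ {i j} → i < j → below i j ≡ 1
below-true {i} {j} i<j = cong [_] (dec-true (i <? j) i<j)

below-false : ∀ {i j} → ¬ i < j → below i j ≡ 0
below-false {i} {j} i≮j = cong [_] (dec-false (i <? j) i≮j)

below≤1 : ∀ i j → below i j ≤ 1
below≤1 i j with i <? j
... | yes i<j = ≤-reflexive (below-true i<j)
... | no  i≮j = ≤-trans (≤-reflexive (below-false i≮j)) z≤n

below-mono : ∀ {i i′ j j′} → i′ ≤ i → j ≤ j′ → below i j ≤ below i′ j′
below-mono {i} {i′} {j} {j′} i′≤i j≤j′ with i <? j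
... | no  i≮j = ≤-trans (≤-reflexive (below-false i≮j)) z≤n
... | yes i<j = ≤-trans (below≤1 i j) (≤-reflexive (sym (below-true (≤-<-trans i′≤i (<-≤-trans i<j j≤j′)))))

m*below≤m : ∀ m i j → m * below i j ≤ m
m*below≤m m i j = ≤-trans (*-monoʳ-≤ m (below≤1 i j)) (≤-reflexive (*-identityʳ m))

injective⇒surjective : ∀ {n} (f : Fin n → Fin n) → (∀ {x y} → f x ≡ f y → x ≡ y) → ∀ y → ∃ λ x → f x ≡ y
injective⇒surjective {suc m} f f-injective y with any? (λ x → f x ≟ y)
... | yes hit = hit
... | no  miss = ⊥-elim (1+n≰n (injective⇒≤ g-injective))
  where
  y≢f : ∀ x → y ≢ f x
  y≢f x y≡fx = miss (x , sym y≡fx)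
  g : Fin (suc m) → Fin m
  g x = punchOut (y≢f x)
  g-injective : ∀ {x z} → g x ≡ g z → x ≡ z
  g-injective {x} {z} gx≡gz = f-injective (punchOut-injective (y≢f x) (y≢f z) gx≡gz)

injective⇒↔ : ∀ {n} (f : Fin n → Fin n) → (∀ {x y} → f x ≡ f y → x ≡ y) → Fin n ↔ Fin n
injective⇒↔ f f-injective = mk↔ₛ′ f (λ y → proj₁ (surjective y)) (λ y → proj₂ (surjective y))
  (λ x → f-injective (proj₂ (surjective (f x))))
  where
  surjective : ∀ y → ∃ λ x → f x ≡ y
  surjective = injective⇒surjective f f-injective

module Components {n} (G : Graph n) (complete : LocallyComplete G) where

  -- Local completeness makes "equal or adjacent" transitive; its classes are the components, each a clique.
  infix 4 _∼_ _∼?_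
  _∼_ : Fin n → Fin n → Set
  u ∼ v = u ≡ v ⊎ adj G u v ≡ true

  _∼?_ : ∀ u v → Dec (u ∼ v)
  u ∼? v = (u ≟ v) ⊎-dec (adj G u v ≟ᵇ true)

  ∼-refl : ∀ {v} → v ∼ v
  ∼-refl = inj₁ refl

  ∼-sym : ∀ {u v} → u ∼ v → v ∼ u
  ∼-sym (inj₁ refl) = inj₁ refl
  ∼-sym (inj₂ u~v)  = inj₂ (trans (adj-sym G _ _) u~v)

  ∼-trans : ∀ {u v w} → u ∼ v → v ∼ w → u ∼ w
  ∼-trans (inj₁ refl) v∼w = v∼w
  ∼-trans u∼v (inj₁ refl) = u∼v
  ∼-trans {u} {v} {w} (inj₂ u~v) (inj₂ v~w) with u ≟ w
  ... | yes u≡w = inj₁ u≡w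
  ... | no  u≢w = inj₂ (complete u v w (trans (adj-sym G v u) u~v) v~w u≢w)

  ≠*∼≡A : ∀ u v → [ u ≠ v ] * [ does (u ∼? v) ] ≡ A G u v
  ≠*∼≡A u v with u ≟ v
  ... | yes refl = sym (A-diag G u)
  ... | no  _    with adj G u v
  ...   | true  = refl
  ...   | false = refl

  least : ∀ v → Σ (Fin n) λ m → m ∼ v × (∀ {u} → u ∼ v → toℕ m ≤ toℕ u)
  least v with ¬∀⟶∃¬-smallest n (λ u → ¬ u ∼ v) (λ u → ¬? (u ∼? v)) (λ ∀≁ → ∀≁ v ∼-refl)
  ... | m , ¬¬m∼v , ≁-below = m , decidable-stable (m ∼? v) ¬¬m∼v , minimal
    where
    minimal : ∀ {u} → u ∼ v → toℕ m ≤ toℕ u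
    minimal {u} u∼v = ≮⇒≥ λ u<m → ≁-below (fromℕ< u<m)
      (subst (_∼ v) (sym (toℕ-injective (trans (toℕ-inject (fromℕ< u<m)) (toℕ-fromℕ< u<m)))) u∼v)

  leader : Fin n → Fin n
  leader v = proj₁ (least v)

  leader-∼ : ∀ v → leader v ∼ v
  leader-∼ v = proj₁ (proj₂ (least v))

  leader-minimal : ∀ {u v} → u ∼ v → toℕ (leader v) ≤ toℕ u
  leader-minimal {v = v} = proj₂ (proj₂ (least v))

  leader-cong : ∀ {u v} → u ∼ v → leader u ≡ leader v
  leader-cong {u} {v} u∼v = toℕ-injective (≤-antisym
    (leader-minimal (∼-trans (leader-∼ v) (∼-sym u∼v))) (leader-minimal (∼-trans (leader-∼ u) u∼v)))

  leader-injective : ∀ {u v} → leader u ≡ leader v → u ∼ v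
  leader-injective {u} {v} lu≡lv = ∼-trans (∼-sym (leader-∼ u)) (subst (_∼ v) (sym lu≡lv) (leader-∼ v))

  isLeader : Fin n → ℕ
  isLeader m = [ does (leader m ≟ m) ]

  isLeader-leader : ∀ v → isLeader (leader v) ≡ 1
  isLeader-leader v = cong [_] (dec-true (leader (leader v) ≟ leader v) (leader-cong (leader-∼ v)))

  index : Fin n → ℕ
  index v = ∑[ m < n ] (isLeader m * below (toℕ m) (toℕ (leader v)))

  index-cong : ∀ {u v} → u ∼ v → index u ≡ index v
  index-cong u∼v = cong (λ l → ∑[ m < n ] (isLeader m * below (toℕ m) (toℕ l))) (leader-cong u∼v)

  index-mono : ∀ {u v} → toℕ (leader u) < toℕ (leader v) → index u < index v
  index-mono {u} {v} lu<lv = ∑-mono-< pointwise (leader u) strict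
    where
    pointwise : ∀ m → isLeader m * below (toℕ m) (toℕ (leader u)) ≤ isLeader m * below (toℕ m) (toℕ (leader v))
    pointwise m = *-monoʳ-≤ (isLeader m) (below-mono (≤-reflexive refl) (<⇒≤ lu<lv))
    strict : isLeader (leader u) * below (toℕ (leader u)) (toℕ (leader u)) <
             isLeader (leader u) * below (toℕ (leader u)) (toℕ (leader v))
    strict = subst₂ _<_ (sym (cong₂ _*_ (isLeader-leader u) (below-false {toℕ (leader u)} (<-irrefl refl))))
                        (sym (cong₂ _*_ (isLeader-leader u) (below-true lu<lv))) (s≤s z≤n)

  index-injective : ∀ {u v} → index u ≡ index v → u ∼ v
  index-injective {u} {v} iu≡iv with <-cmp (toℕ (leader u)) (toℕ (leader v))
  ... | tri< lu<lv _ _ = ⊥-elim (<-irrefl iu≡iv (index-mono lu<lv))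
  ... | tri≈ _ lu≡lv _ = leader-injective (toℕ-injective lu≡lv)
  ... | tri> _ _ lv<lu = ⊥-elim (<-irrefl (sym iu≡iv) (index-mono lv<lu))

  components : ℕ
  components = ∑[ m < n ] isLeader m

  index< : ∀ v → index v < components
  index< v = ∑-mono-< (λ m → m*below≤m (isLeader m) (toℕ m) (toℕ (leader v))) (leader v) strict
    where
    strict : isLeader (leader v) * below (toℕ (leader v)) (toℕ (leader v)) < isLeader (leader v)
    strict = subst₂ _<_ (sym (cong₂ _*_ (isLeader-leader v) (below-false {toℕ (leader v)} (<-irrefl refl))))
                        (sym (isLeader-leader v)) (s≤s z≤n)

  ∼⇒adj : ∀ {u v} → u ∼ v → u ≢ v → adj G u v ≡ true
  ∼⇒adj (inj₁ u≡v) u≢v = ⊥-elim (u≢v u≡v)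
  ∼⇒adj (inj₂ u~v) _   = u~v

  module _ {d} (regular : Regular d G) where

    closed-neighbourhood : ∀ v → ∑[ u < n ] [ does (v ∼? u) ] ≡ suc d
    closed-neighbourhood v = begin
      ∑[ u < n ] [ does (v ∼? u) ]                           ≡⟨ ∑-split v (λ u → [ does (v ∼? u) ]) ⟩
      [ does (v ∼? v) ] + ∑[ u < n ] ([ v ≠ u ] * [ does (v ∼? u) ])
        ≡⟨ cong₂ _+_ (cong [_] (dec-true (v ∼? v) ∼-refl)) (sum-cong-≗ (≠*∼≡A v)) ⟩
      1 + ∑[ u < n ] A G v u                                  ≡⟨ cong suc (degree≡ G regular v) ⟩
      suc d                                                   ∎
      where open ≡-Reasoning

    unique-leader : ∀ v → ∑[ m < n ] (isLeader m * [ does (m ∼? v) ]) ≡ 1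
    unique-leader v = trans (sum-cong-≗ pointwise) (∑-δ (leader v) (λ _ → 1))
      where
      pointwise : ∀ m → isLeader m * [ does (m ∼? v) ] ≡ [ does (leader v ≟ m) ] * 1
      pointwise m with m ∼? v
      ... | yes m∼v = trans (cong (λ b → isLeader m * [ b ]) (dec-true (m ∼? v) m∼v))
                            (cong (λ l → [ does (l ≟ m) ] * 1) (leader-cong m∼v))
      ... | no  m≁v = trans (cong (λ b → isLeader m * [ b ]) (dec-false (m ∼? v) m≁v)) (trans (*-zeroʳ (isLeader m))
                            (cong (λ b → [ b ] * 1) (sym (dec-false (leader v ≟ m) λ { refl → m≁v (leader-∼ v) }))))

    n≡components*[1+d] : n ≡ components * suc d
    n≡components*[1+d] = begin
      n                                                             ≡⟨ *-identityʳ n ⟨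
      n * 1                                                         ≡⟨ ∑-const n 1 ⟨
      ∑[ v < n ] 1                                                  ≡⟨ sum-cong-≗ unique-leader ⟨
      ∑[ v < n ] ∑[ m < n ] (isLeader m * [ does (m ∼? v) ])        ≡⟨ ∑-comm (λ v m → isLeader m * [ does (m ∼? v) ]) ⟩
      ∑[ m < n ] ∑[ v < n ] (isLeader m * [ does (m ∼? v) ])        ≡⟨ sum-cong-≗ (λ m → trans (sym (*-distribˡ-sum (isLeader m) (λ v → [ does (m ∼? v) ])))
                                                                          (cong (isLeader m *_) (closed-neighbourhood m))) ⟩
      ∑[ m < n ] (isLeader m * suc d)                               ≡⟨ *-distribʳ-sum (suc d) isLeader ⟨
      components * suc d                                            ∎
      where open ≡-Reasoning

    rank : Fin n → ℕ
    rank v = ∑[ w < n ] (A G w v * below (toℕ w) (toℕ v))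

    rank≤d : ∀ v → rank v ≤ d
    rank≤d v = begin
      rank v                ≤⟨ ∑-mono-≤ (λ w → m*below≤m (A G w v) (toℕ w) (toℕ v)) ⟩
      ∑[ w < n ] A G w v    ≡⟨ trans (sum-cong-≗ λ w → A-sym G w v) (degree≡ G regular v) ⟩
      d                     ∎
      where open ≤-Reasoning

    rank-mono : ∀ {u v} → u ∼ v → toℕ u < toℕ v → rank u < rank v
    rank-mono {u} {v} u∼v u<v = ∑-mono-< pointwise u strict
      where
      u≢v : u ≢ v
      u≢v refl = <-irrefl refl u<v
      pointwise : ∀ w → A G w u * below (toℕ w) (toℕ u) ≤ A G w v * below (toℕ w) (toℕ v)
      pointwise w with adj G w u in w~u | toℕ w <? toℕ u
      ... | false | _       = z≤n
      ... | true  | no  w≮u = ≤-trans (≤-reflexive (cong (1 *_) (below-false w≮u))) z≤n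
      ... | true  | yes w<u = ≤-reflexive (trans (cong (1 *_) (below-true w<u))
            (sym (cong₂ _*_ (cong [_] (∼⇒adj (∼-trans (inj₂ w~u) u∼v) λ { refl → <-asym w<u u<v })) (below-true (<-trans w<u u<v)))))
      strict : A G u u * below (toℕ u) (toℕ u) < A G u v * below (toℕ u) (toℕ v)
      strict = subst₂ _<_ (sym (cong (_* below (toℕ u) (toℕ u)) (A-diag G u)))
                          (sym (cong₂ _*_ (cong [_] (∼⇒adj u∼v u≢v)) (below-true u<v))) (s≤s z≤n)

    -- Components are numbered by the order of their least vertices, and v is sent to the block of its
    -- component, at the offset given by the number of its neighbours smaller than v.
    position : Fin n → ℕ
    position v = index v * suc d + rank v

    position<n : ∀ v → position v < n
    position<n v = begin-strict
      index v * suc d + rank v   <⟨ +-monoʳ-< (index v * suc d) (s≤s (rank≤d v)) ⟩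
      index v * suc d + suc d    ≡⟨ +-comm (index v * suc d) (suc d) ⟩
      suc (index v) * suc d      ≤⟨ *-monoˡ-≤ (suc d) (index< v) ⟩
      components * suc d         ≡⟨ n≡components*[1+d] ⟨
      n                          ∎
      where open ≤-Reasoning

    σ : Fin n → Fin n
    σ v = fromℕ< (position<n v)

    σ/[1+d]≡index : ∀ v → toℕ (σ v) / suc d ≡ index v
    σ/[1+d]≡index v = begin
      toℕ (σ v) / suc d                                ≡⟨ cong (_/ suc d) (toℕ-fromℕ< (position<n v)) ⟩
      (index v * suc d + rank v) / suc d               ≡⟨ +-distrib-/-∣ˡ (rank v) (divides (index v) refl) ⟩
      index v * suc d / suc d + rank v / suc d         ≡⟨ cong₂ _+_ (m*n/n≡m (index v) (suc d)) (m<n⇒m/n≡0 (s≤s (rank≤d v))) ⟩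
      index v + 0                                      ≡⟨ +-identityʳ (index v) ⟩
      index v                                          ∎
      where open ≡-Reasoning

    rank-injective : ∀ {u v} → u ∼ v → rank u ≡ rank v → u ≡ v
    rank-injective {u} {v} u∼v ru≡rv with <-cmp (toℕ u) (toℕ v)
    ... | tri< u<v _ _ = ⊥-elim (<-irrefl ru≡rv (rank-mono u∼v u<v))
    ... | tri≈ _ u≡v _ = toℕ-injective u≡v
    ... | tri> _ _ v<u = ⊥-elim (<-irrefl (sym ru≡rv) (rank-mono (∼-sym u∼v) v<u))

    σ-injective : ∀ {u v} → σ u ≡ σ v → u ≡ v
    σ-injective {u} {v} σu≡σv = rank-injective (index-injective index-u≡index-v) rank-u≡rank-v
      where
      index-u≡index-v : index u ≡ index v
      index-u≡index-v = trans (sym (σ/[1+d]≡index u)) (trans (cong (λ x → toℕ x / suc d) σu≡σv) (σ/[1+d]≡index v))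
      rank-u≡rank-v : rank u ≡ rank v
      rank-u≡rank-v = +-cancelˡ-≡ (index u * suc d) (rank u) (rank v)
        (trans (sym (toℕ-fromℕ< (position<n u))) (trans (cong toℕ σu≡σv)
          (trans (toℕ-fromℕ< (position<n v)) (cong (λ i → i * suc d + rank v) (sym index-u≡index-v)))))

    σ-preserves-adj : ∀ u v → adj G u v ≡ cliquesAdj d (σ u) (σ v)
    σ-preserves-adj u v with u ≟ v
    ... | yes refl = trans (loopless G u) (cong (_∧ sameBlock d (σ u) (σ u)) (sym (≠-irrefl (σ u))))
    ... | no  u≢v  = trans adj≡same-index (cong₂ _∧_ (sym (≢⇒≠ (u≢v ∘ σ-injective)))
                       (sym (cong₂ _≡ᵇ_ (σ/[1+d]≡index u) (σ/[1+d]≡index v))))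
      where
      adj≡same-index : adj G u v ≡ (index u ≡ᵇ index v)
      adj≡same-index = ⇔→≡ (mk⇔
        (λ u~v → Equivalence.from (≡ᵇ⇔≡ (index u) (index v)) (index-cong (inj₂ u~v)))
        (λ same → ∼⇒adj (index-injective (Equivalence.to (≡ᵇ⇔≡ (index u) (index v)) same)) u≢v))

    complete⇒isomorphic : Isomorphic G (disjointCliques n d)
    complete⇒isomorphic = injective⇒↔ σ σ-injective , σ-preserves-adj

isomorphic-complete : ∀ {n} (G H : Graph n) → Isomorphic G H → LocallyComplete H → LocallyComplete G
isomorphic-complete G H (σ , σ-adj) H-complete u v w v~u v~w u≢w =
  trans (σ-adj u w) (H-complete (to u) (to v) (to w) (trans (sym (σ-adj v u)) v~u) (trans (sym (σ-adj v w)) v~w) (u≢w ∘ injective))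
  where open Injection (↔⇒↣ σ)

open import Data.Integer using (+_; _-_; -_; +≤+) renaming (_≥_ to _≥ℤ_; _+_ to _+ℤ_; _≤_ to _≤ℤ_)
open import Data.Integer.Properties using (pos-+; +-injective) renaming (+-monoˡ-≤ to +ℤ-monoˡ-≤)
open import Data.Integer.Tactic.RingSolver using () renaming (solve-∀ to solve-∀ℤ)

ℤ-difference-shift : ∀ a b k → (+ a) - (+ b) ≡ + (a + k) - + (b + k)
ℤ-difference-shift a b k = trans (shift (+ a) (+ b) (+ k)) (sym (cong₂ _-_ (pos-+ a k) (pos-+ b k)))
  where
  shift : ∀ x y z → x - y ≡ (x +ℤ z) - (y +ℤ z)
  shift = solve-∀ℤ

ℤ-difference-≥ : ∀ a b c e → c + b ≤ a + e → (+ a) - (+ b) ≥ℤ (+ c) - (+ e)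
ℤ-difference-≥ a b c e c+b≤a+e = subst₂ _≤ℤ_
  (sym (trans (ℤ-difference-shift c e b) (cong (λ k → + (c + b) - + k) (+-comm e b))))
  (sym (ℤ-difference-shift a b e))
  (+ℤ-monoˡ-≤ (- (+ (b + e))) (+≤+ c+b≤a+e))

ℤ-difference-≡ : ∀ a b c e → ((+ a) - (+ b) ≡ (+ c) - (+ e)) ⇔ c + b ≡ a + e
ℤ-difference-≡ a b c e = mk⇔
  (λ eq → +-injective (begin
    + (c + b)                     ≡⟨ pos-+ c b ⟩
    + c +ℤ + b                    ≡⟨ regroup (+ c) (+ e) (+ b) ⟩
    (+ c - + e) +ℤ (+ b +ℤ + e)   ≡⟨ cong (_+ℤ (+ b +ℤ + e)) eq ⟨
    (+ a - + b) +ℤ (+ b +ℤ + e)   ≡⟨ regroup′ (+ a) (+ b) (+ e) ⟨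
    + a +ℤ + e                    ≡⟨ pos-+ a e ⟨
    + (a + e)                     ∎))
  (λ c+b≡a+e → begin
    + a - + b              ≡⟨ ℤ-difference-shift a b e ⟩
    + (a + e) - + (b + e)  ≡⟨ cong (λ m → + m - + (b + e)) c+b≡a+e ⟨
    + (c + b) - + (b + e)  ≡⟨ cong (λ k → + (c + b) - + k) (+-comm b e) ⟩
    + (c + b) - + (e + b)  ≡⟨ ℤ-difference-shift c e b ⟨
    + c - + e              ∎)
  where
  open ≡-Reasoning
  regroup : ∀ x y z → x +ℤ z ≡ (x - y) +ℤ (z +ℤ y)
  regroup = solve-∀ℤ
  regroup′ : ∀ x y z → x +ℤ z ≡ (x - y) +ℤ (y +ℤ z)
  regroup′ = solve-∀ℤ

lemma3p1 : (d n : ℕ) → d ≥ 1 → suc d ∣ n → (G : Graph n) → Regular d G →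
    ((+ p4 G) - (+ c4 G) ≥ℤ (+ p4 (disjointCliques n d)) - (+ c4 (disjointCliques n d)))
    × (((+ p4 G) - (+ c4 G) ≡ (+ p4 (disjointCliques n d)) - (+ c4 (disjointCliques n d)))
    ⇔ Isomorphic G (disjointCliques n d))
lemma3p1 zero     _ () _ _ _
lemma3p1 (suc d′) _ _  (divides q refl) G regular =
  ℤ-difference-≥ (p4 G) (c4 G) (p4 G₀) (c4 G₀) (proj₁ comparison) ,
  complete⇔isomorphic ⇔-∘ (proj₂ comparison ⇔-∘ ℤ-difference-≡ (p4 G) (c4 G) (p4 G₀) (c4 G₀))
  where
  G₀ : Graph (q * (2 + d′))
  G₀ = disjointCliques (q * (2 + d′)) (suc d′)
  G₀-complete : LocallyComplete G₀
  G₀-complete = disjointCliques-complete (q * (2 + d′)) (suc d′)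
  comparison : (p4 G₀ + c4 G ≤ p4 G + c4 G₀) × (p4 G₀ + c4 G ≡ p4 G + c4 G₀ ⇔ LocallyComplete G)
  comparison = complete-minimises-p4-c4 G G₀ regular (disjointCliques-regular q (suc d′)) G₀-complete (8∣disjointCliques-c4 q d′)
  complete⇔isomorphic : LocallyComplete G ⇔ Isomorphic G G₀
  complete⇔isomorphic = mk⇔ (λ complete → Components.complete⇒isomorphic G complete regular)
                            (λ G≅G₀ → isomorphic-complete G G₀ G≅G₀ G₀-complete)
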